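{- Let $G$ be a finite simple graph with $n$ vertices, vertex degrees $d_1,\dots,d_n$, and Kirchhoff matrix $K$. Then $\det(1+K) \leq \prod_{k=1}^n (1+2d_k)$.
   Context: For a finite simple graph with vertex set $\{1,\dots,n\}$, the Kirchhoff matrix is $K=B-A$, where $B$ is the diagonal matrix of vertex degrees and $A$ is the adjacency matrix; $1$ denotes the $n\times n$ identity matrix. -}

module Defs where

open import Data.Nat using (ℕ; zero; suc)
open import Data.Bool using (Bool; true; false; if_then_else_)
open import Data.Fin using (Fin; zero; suc; punchIn; _≟_)
open import Data.Integer using (ℤ; +_; _+_; _*_; _-_; -_)
open import Data.List using (List; []; _∷_; foldr; map)
open import Data.List using (allFin)
open import Data.Product using (_×_)
open import Relation.Binary.PropositionalEquality using (_≡_)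
open import Relation.Nullary using (yes; no; ¬_)

record SimpleGraph (n : ℕ) : Set where
  field
    adj       : Fin n → Fin n → Bool
    adj-sym   : ∀ i j → adj i j ≡ adj j i
    adj-irrefl : ∀ i → adj i i ≡ false

open SimpleGraph public

Matrix : ℕ → Set
Matrix n = Fin n → Fin n → ℤ

∑ : ∀ {n} → (Fin n → ℤ) → ℤ
∑ {n} f = foldr _+_ (+ 0) (map f (allFin n))

∏ : ∀ {n} → (Fin n → ℤ) → ℤ
∏ {n} f = foldr _*_ (+ 1) (map f (allFin n))

b2z : Bool → ℤ
b2z true  = + 1
b2z false = + 0

degree : ∀ {n} → SimpleGraph n → Fin n → ℤ
degree G i = ∑ (λ j → b2z (adj G i j))

δ : ∀ {n} → Fin n → Fin n → ℤ
δ i j with i ≟ j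
... | yes _ = + 1
... | no _  = + 0

identity : ∀ {n} → Matrix n
identity = δ

adjMatrix : ∀ {n} → SimpleGraph n → Matrix n
adjMatrix G i j = b2z (adj G i j)

degMatrix : ∀ {n} → SimpleGraph n → Matrix n
degMatrix G i j = δ i j * degree G i

kirchhoff : ∀ {n} → SimpleGraph n → Matrix n
kirchhoff G i j = degMatrix G i j - adjMatrix G i j

_⊕_ : ∀ {n} → Matrix n → Matrix n → Matrix n
(M ⊕ N) i j = M i j + N i j

sgn : ℕ → ℤ
sgn zero = + 1
sgn (suc zero) = - (+ 1)
sgn (suc (suc k)) = sgn k

det : ∀ {n} → Matrix n → ℤ
det {zero}  M = + 1
det {suc n} M = ∑ (λ (j : Fin (suc n)) →
  sgn (Data.Fin.toℕ j) * (M zero j * det (λ (r c : Fin n) → M (suc r) (punchIn j c))))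

-- Expanding det M along the first row and bounding each term by the triangle
-- inequality gives |det M| ≤ ∏ₖ Σⱼ |Mₖⱼ| for every integer matrix M.  In row k
-- of 1 + K the diagonal entry is 1 + dₖ and exactly dₖ further entries equal
-- −1, so the k-th absolute row sum is 1 + 2dₖ.
module Submission where

open import Defs
open import Data.Bool using (Bool; true; false)
open import Data.Fin using (Fin; zero; suc; punchIn; toℕ; _≟_)
open import Data.Fin.Properties using (suc-injective)
open import Data.Integer using (ℤ; +_; -[1+_]; _+_; _*_; _≤_; ∣_∣; +≤+; -≤+)
import Data.Integer.Properties as ℤ
open import Data.List using (_∷_; foldr; map; allFin)
open import Data.List.Properties using (map-tabulate)
open import Data.Nat as ℕ using (ℕ; z≤n)
open import Data.Nat.Properties
  using (≤-refl; +-mono-≤; *-mono-≤; *-monoʳ-≤; m≤n+m; +-assoc; +-comm;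
         *-distribʳ-+; *-identityˡ; +-identityʳ; module ≤-Reasoning)
open import Data.Empty using (⊥-elim)
open import Function using (_∘_; id)
open import Relation.Binary.PropositionalEquality
open import Relation.Nullary using (yes; no)

Σ : ∀ {n} → (Fin n → ℕ) → ℕ
Σ {ℕ.zero}  f = 0
Σ {ℕ.suc n} f = f zero ℕ.+ Σ (f ∘ suc)

Π : ∀ {n} → (Fin n → ℕ) → ℕ
Π {ℕ.zero}  f = 1
Π {ℕ.suc n} f = f zero ℕ.* Π (f ∘ suc)

Σ-cong : ∀ {n} {f g : Fin n → ℕ} → (∀ i → f i ≡ g i) → Σ f ≡ Σ g
Σ-cong {ℕ.zero}  f≗g = refl
Σ-cong {ℕ.suc n} f≗g = cong₂ ℕ._+_ (f≗g zero) (Σ-cong (f≗g ∘ suc))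

Σ-mono-≤ : ∀ {n} {f g : Fin n → ℕ} → (∀ i → f i ℕ.≤ g i) → Σ f ℕ.≤ Σ g
Σ-mono-≤ {ℕ.zero}  f≤g = z≤n
Σ-mono-≤ {ℕ.suc n} f≤g = +-mono-≤ (f≤g zero) (Σ-mono-≤ (f≤g ∘ suc))

Π-mono-≤ : ∀ {n} {f g : Fin n → ℕ} → (∀ i → f i ℕ.≤ g i) → Π f ℕ.≤ Π g
Π-mono-≤ {ℕ.zero}  f≤g = ≤-refl
Π-mono-≤ {ℕ.suc n} f≤g = *-mono-≤ (f≤g zero) (Π-mono-≤ (f≤g ∘ suc))

Σ-*-distribʳ : ∀ {n} (f : Fin n → ℕ) (c : ℕ) → Σ (λ i → f i ℕ.* c) ≡ Σ f ℕ.* c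
Σ-*-distribʳ {ℕ.zero}  f c = refl
Σ-*-distribʳ {ℕ.suc n} f c = begin
  f zero ℕ.* c ℕ.+ Σ (λ i → f (suc i) ℕ.* c) ≡⟨ cong (f zero ℕ.* c ℕ.+_) (Σ-*-distribʳ (f ∘ suc) c) ⟩
  f zero ℕ.* c ℕ.+ Σ (f ∘ suc) ℕ.* c         ≡⟨ *-distribʳ-+ c (f zero) (Σ (f ∘ suc)) ⟨
  Σ f ℕ.* c                                  ∎
  where open ≡-Reasoning

Σ-punchIn-≤ : ∀ {n} (j : Fin (ℕ.suc n)) (f : Fin (ℕ.suc n) → ℕ) → Σ (f ∘ punchIn j) ℕ.≤ Σ f
Σ-punchIn-≤ zero              f = m≤n+m _ (f zero)
Σ-punchIn-≤ {ℕ.suc n} (suc j) f = +-mono-≤ (≤-refl {f zero}) (Σ-punchIn-≤ j (f ∘ suc))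

Σ-update : ∀ {n} (k : Fin n) (f g : Fin n → ℕ) (c : ℕ) →
  (∀ j → k ≢ j → f j ≡ g j) → f k ≡ c ℕ.+ g k → Σ f ≡ c ℕ.+ Σ g
Σ-update zero f g c f≗g fk = begin
  f zero ℕ.+ Σ (f ∘ suc)       ≡⟨ cong₂ ℕ._+_ fk (Σ-cong (λ j → f≗g (suc j) λ ())) ⟩
  c ℕ.+ g zero ℕ.+ Σ (g ∘ suc) ≡⟨ +-assoc c (g zero) _ ⟩
  c ℕ.+ Σ g                    ∎
  where open ≡-Reasoning
Σ-update (suc k) f g c f≗g fk = begin
  f zero ℕ.+ Σ (f ∘ suc)         ≡⟨ cong₂ ℕ._+_ (f≗g zero λ ()) (Σ-update k (f ∘ suc) (g ∘ suc) c
                                      (λ j k≢j → f≗g (suc j) (k≢j ∘ suc-injective)) fk) ⟩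
  g zero ℕ.+ (c ℕ.+ Σ (g ∘ suc)) ≡⟨ +-assoc (g zero) c _ ⟨
  g zero ℕ.+ c ℕ.+ Σ (g ∘ suc)   ≡⟨ cong (ℕ._+ Σ (g ∘ suc)) (+-comm (g zero) c) ⟩
  c ℕ.+ g zero ℕ.+ Σ (g ∘ suc)   ≡⟨ +-assoc c (g zero) _ ⟩
  c ℕ.+ Σ g                      ∎
  where open ≡-Reasoning

foldr-map-allFin-suc : ∀ {n} {A : Set} (_∙_ : ℤ → A → A) (e : A) (f : Fin (ℕ.suc n) → ℤ) →
  foldr _∙_ e (map f (allFin (ℕ.suc n))) ≡ f zero ∙ foldr _∙_ e (map (f ∘ suc) (allFin n))
foldr-map-allFin-suc _∙_ e f = cong (foldr _∙_ e)
  (trans (map-tabulate id f) (cong (f zero ∷_) (sym (map-tabulate id (f ∘ suc)))))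

∑≡+Σ : ∀ {n} {f : Fin n → ℤ} {g : Fin n → ℕ} → (∀ i → f i ≡ + g i) → ∑ f ≡ + Σ g
∑≡+Σ {ℕ.zero}          f≗g = refl
∑≡+Σ {ℕ.suc n} {f} {g} f≗g = begin
  ∑ f                        ≡⟨ foldr-map-allFin-suc _+_ (+ 0) f ⟩
  f zero + ∑ (f ∘ suc)       ≡⟨ cong₂ _+_ (f≗g zero) (∑≡+Σ (f≗g ∘ suc)) ⟩
  + g zero + + Σ (g ∘ suc)   ≡⟨ ℤ.pos-+ (g zero) (Σ (g ∘ suc)) ⟨
  + Σ g                      ∎
  where open ≡-Reasoning

∏≡+Π : ∀ {n} {f : Fin n → ℤ} {g : Fin n → ℕ} → (∀ i → f i ≡ + g i) → ∏ f ≡ + Π g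
∏≡+Π {ℕ.zero}          f≗g = refl
∏≡+Π {ℕ.suc n} {f} {g} f≗g = begin
  ∏ f                        ≡⟨ foldr-map-allFin-suc _*_ (+ 1) f ⟩
  f zero * ∏ (f ∘ suc)       ≡⟨ cong₂ _*_ (f≗g zero) (∏≡+Π (f≗g ∘ suc)) ⟩
  + g zero * + Π (g ∘ suc)   ≡⟨ ℤ.pos-* (g zero) (Π (g ∘ suc)) ⟨
  + Π g                      ∎
  where open ≡-Reasoning

∣∑∣≤Σ∣∣ : ∀ {n} (f : Fin n → ℤ) → ∣ ∑ f ∣ ℕ.≤ Σ (∣_∣ ∘ f)
∣∑∣≤Σ∣∣ {ℕ.zero}  f = z≤n
∣∑∣≤Σ∣∣ {ℕ.suc n} f = begin
  ∣ ∑ f ∣                         ≡⟨ cong ∣_∣ (foldr-map-allFin-suc _+_ (+ 0) f) ⟩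
  ∣ f zero + ∑ (f ∘ suc) ∣        ≤⟨ ℤ.∣i+j∣≤∣i∣+∣j∣ (f zero) (∑ (f ∘ suc)) ⟩
  ∣ f zero ∣ ℕ.+ ∣ ∑ (f ∘ suc) ∣  ≤⟨ +-mono-≤ (≤-refl {∣ f zero ∣}) (∣∑∣≤Σ∣∣ (f ∘ suc)) ⟩
  Σ (∣_∣ ∘ f)                     ∎
  where open ≤-Reasoning

i≤+∣i∣ : ∀ i → i ≤ + ∣ i ∣
i≤+∣i∣ (+ n)    = ℤ.≤-refl
i≤+∣i∣ -[1+ n ] = -≤+

∣sgn*i∣≡∣i∣ : ∀ k i → ∣ sgn k * i ∣ ≡ ∣ i ∣
∣sgn*i∣≡∣i∣ ℕ.zero            i = cong ∣_∣ (ℤ.*-identityˡ i)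
∣sgn*i∣≡∣i∣ (ℕ.suc ℕ.zero)    i = trans (ℤ.∣i*j∣≡∣i∣*∣j∣ (sgn 1) i) (*-identityˡ ∣ i ∣)
∣sgn*i∣≡∣i∣ (ℕ.suc (ℕ.suc k)) i = ∣sgn*i∣≡∣i∣ k i

rowNorm : ∀ {n} → Matrix n → Fin n → ℕ
rowNorm M i = Σ (λ j → ∣ M i j ∣)

minor : ∀ {n} → Matrix (ℕ.suc n) → Fin (ℕ.suc n) → Matrix n
minor M j r c = M (suc r) (punchIn j c)

∣det∣≤Π-rowNorm : ∀ {n} (M : Matrix n) → ∣ det M ∣ ℕ.≤ Π (rowNorm M)
∣det∣≤Π-rowNorm {ℕ.zero}  M = ≤-refl
∣det∣≤Π-rowNorm {ℕ.suc n} M = begin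
  ∣ det M ∣                                       ≤⟨ ∣∑∣≤Σ∣∣ term ⟩
  Σ (∣_∣ ∘ term)                                  ≤⟨ Σ-mono-≤ ∣term∣≤ ⟩
  Σ (λ j → ∣ M zero j ∣ ℕ.* Π (rowNorm M ∘ suc)) ≡⟨ Σ-*-distribʳ (λ j → ∣ M zero j ∣) _ ⟩
  Π (rowNorm M)                                   ∎
  where
  open ≤-Reasoning
  term : Fin (ℕ.suc n) → ℤ
  term j = sgn (toℕ j) * (M zero j * det (minor M j))
  ∣term∣≤ : ∀ j → ∣ term j ∣ ℕ.≤ ∣ M zero j ∣ ℕ.* Π (rowNorm M ∘ suc)
  ∣term∣≤ j = begin
    ∣ term j ∣                               ≡⟨ ∣sgn*i∣≡∣i∣ (toℕ j) _ ⟩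
    ∣ M zero j * det (minor M j) ∣           ≡⟨ ℤ.∣i*j∣≡∣i∣*∣j∣ (M zero j) _ ⟩
    ∣ M zero j ∣ ℕ.* ∣ det (minor M j) ∣     ≤⟨ *-monoʳ-≤ ∣ M zero j ∣ (∣det∣≤Π-rowNorm (minor M j)) ⟩
    ∣ M zero j ∣ ℕ.* Π (rowNorm (minor M j)) ≤⟨ *-monoʳ-≤ ∣ M zero j ∣
                                                  (Π-mono-≤ (λ r → Σ-punchIn-≤ j (λ c → ∣ M (suc r) c ∣))) ⟩
    ∣ M zero j ∣ ℕ.* Π (rowNorm M ∘ suc)     ∎

bool→ℕ : Bool → ℕ
bool→ℕ true  = 1
bool→ℕ false = 0

degreeℕ : ∀ {n} → SimpleGraph n → Fin n → ℕ
degreeℕ G k = Σ (λ j → bool→ℕ (adj G k j))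

b2z≡+bool→ℕ : ∀ b → b2z b ≡ + bool→ℕ b
b2z≡+bool→ℕ true  = refl
b2z≡+bool→ℕ false = refl

degree≡+degreeℕ : ∀ {n} (G : SimpleGraph n) k → degree G k ≡ + degreeℕ G k
degree≡+degreeℕ G k = ∑≡+Σ (λ j → b2z≡+bool→ℕ (adj G k j))

∣1+K∣-offDiag : ∀ {n} (G : SimpleGraph n) k j → k ≢ j →
  ∣ (identity ⊕ kirchhoff G) k j ∣ ≡ bool→ℕ (adj G k j)
∣1+K∣-offDiag G k j k≢j with k ≟ j
... | yes k≡j = ⊥-elim (k≢j k≡j)
... | no _ with adj G k j
...   | true  = refl
...   | false = refl

∣1+K∣-diag : ∀ {n} (G : SimpleGraph n) k →
  ∣ (identity ⊕ kirchhoff G) k k ∣ ≡ ℕ.suc (degreeℕ G k) ℕ.+ bool→ℕ (adj G k k)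
∣1+K∣-diag G k with k ≟ k
... | no k≢k = ⊥-elim (k≢k refl)
... | yes _ rewrite adj-irrefl G k | degree≡+degreeℕ G k
                  | ℤ.*-identityˡ (+ degreeℕ G k) | +-identityʳ (degreeℕ G k) = refl

rowNorm-1+K : ∀ {n} (G : SimpleGraph n) k →
  rowNorm (identity ⊕ kirchhoff G) k ≡ ℕ.suc (degreeℕ G k) ℕ.+ degreeℕ G k
rowNorm-1+K G k = Σ-update k _ (λ j → bool→ℕ (adj G k j)) (ℕ.suc (degreeℕ G k))
  (∣1+K∣-offDiag G k) (∣1+K∣-diag G k)

1+2d≡rowNorm-1+K : ∀ {n} (G : SimpleGraph n) k →
  (+ 1) + (+ 2) * degree G k ≡ + rowNorm (identity ⊕ kirchhoff G) k
1+2d≡rowNorm-1+K G k = begin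
  + 1 + + 2 * degree G k               ≡⟨ cong (λ d → + 1 + + 2 * d) (degree≡+degreeℕ G k) ⟩
  + 1 + + 2 * + d                      ≡⟨ cong (λ e → + 1 + e) (ℤ.pos-* 2 d) ⟨
  + (1 ℕ.+ 2 ℕ.* d)                    ≡⟨ cong (λ e → + ℕ.suc (d ℕ.+ e)) (+-identityʳ d) ⟩
  + (ℕ.suc d ℕ.+ d)                    ≡⟨ cong +_ (rowNorm-1+K G k) ⟨
  + rowNorm (identity ⊕ kirchhoff G) k ∎
  where
  open ≡-Reasoning
  d : ℕ
  d = degreeℕ G k

mainTheorem8 : (n : ℕ) (G : SimpleGraph n) →
    det (identity ⊕ kirchhoff G) ≤ ∏ (λ k → (+ 1) + (+ 2) * degree G k)
mainTheorem8 n G = begin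
  det L                                ≤⟨ i≤+∣i∣ (det L) ⟩
  + ∣ det L ∣                          ≤⟨ +≤+ (∣det∣≤Π-rowNorm L) ⟩
  + Π (rowNorm L)                      ≡⟨ ∏≡+Π (1+2d≡rowNorm-1+K G) ⟨
  ∏ (λ k → (+ 1) + (+ 2) * degree G k) ∎
  where
  open ℤ.≤-Reasoning
  L : Matrix n
  L = identity ⊕ kirchhoff G
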